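{- A map $\varepsilon\colon X^{\times}_{\mathrm{irr}}\to\mathcal{P}(M)$ is a Fitch map if and only if for all (not necessarily distinct) colors $m,m'\in M$: (I) for every 3-element subset $\{a,b,c\}\subseteq X$ with $m\in\varepsilon(c,b)$ and $m\notin\varepsilon(a,b)$ we have (1) $m\in\varepsilon(c,a)$, (2) $m'\in\varepsilon(a,c)$ if and only if $m'\in\varepsilon(b,c)$, and (3) if $m\neq m'$ and $m'\notin\varepsilon(c,b)$ then $m'\notin\varepsilon(a,b)$; and (II) for every 4-element subset $\{a,b,c,d\}\subseteq X$ with $m\in\varepsilon(c,b)$ and $m\notin\varepsilon(a,b)$ we have (4) if $m\neq m'$ and $m'\notin\varepsilon(b,d)\cup\varepsilon(c,d)$, then $m'\notin\varepsilon(a,d)$.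
   Context: $X$ is a finite nonempty set, $M$ a finite nonempty set of colors, $X^{\times}_{\mathrm{irr}}=\{(x,y)\in X\times X: x\neq y\}$. A phylogenetic tree on $X$ is a rooted tree whose leaves (non-root vertices of degree $1$) form $X$, whose root has degree $\ge2$ and whose non-root inner vertices have degree $\ge3$; $\mathrm{lca}(x,y)$ is the last common ancestor. An edge-labeled tree $(T,\lambda)$ on $X$ with $M$ is a phylogenetic tree $T$ on $X$ with $\lambda\colon E(T)\to\mathcal{P}(M)$; $e$ is an $m$-edge if $m\in\lambda(e)$. $(T,\lambda)$ explains $\varepsilon$ if for all $(x,y)\in X^{\times}_{\mathrm{irr}}$, $m\in M$: $m\in\varepsilon(x,y)$ iff the path from $\mathrm{lca}(x,y)$ to $y$ contains an $m$-edge; $\varepsilon$ is a Fitch map if some edge-labeled tree explains it. -}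

module Defs where

open import Data.Nat using (ℕ; _≤_)
open import Data.Fin using (Fin)
open import Data.Fin.Subset using (Subset; _∈_; _∉_)
open import Data.Product using (Σ; _×_; _,_)
open import Data.Sum using (_⊎_)
open import Relation.Binary.PropositionalEquality using (_≡_; _≢_)
open import Function.Bundles using (_⇔_)

-- X = Fin n (leaf labels), M = Fin k (colors); P(M) = Subset k.
-- A rooted tree with leaves labelled by X; an inner vertex has c children,
-- the edge to child i carries the label (ls i) ⊆ M.
data Tree (n k : ℕ) : Set where
  leaf : Fin n → Tree n k
  node : (c : ℕ) → (ls : Fin c → Subset k) → (ts : Fin c → Tree n k) → Tree n k

data _∈L_ {n k : ℕ} (x : Fin n) : Tree n k → Set where
  here  : x ∈L leaf x
  there : ∀ {c ls ts} (i : Fin c) → x ∈L ts i → x ∈L node c ls ts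

-- Phylogenetic shape: every inner vertex has at least 2 children (root degree ≥ 2,
-- other inner vertices degree ≥ 3) and no leaf label occurs in two different
-- child subtrees (so each label occurs at most once).
data Phylo {n k : ℕ} : Tree n k → Set where
  leafP : ∀ x → Phylo (leaf x)
  nodeP : ∀ {c ls ts} → 2 ≤ c → (∀ i → Phylo (ts i))
        → (∀ i j x → x ∈L ts i → x ∈L ts j → i ≡ j)
        → Phylo (node c ls ts)

PhyloTree : {n k : ℕ} → Tree n k → Set
PhyloTree {n} T = Phylo T × ((x : Fin n) → x ∈L T)

data RootPathHas {n k : ℕ} (m : Fin k) (y : Fin n) : Tree n k → Set where
  step : ∀ {c ls ts} (i : Fin c) → y ∈L ts i
       → (m ∈ ls i ⊎ RootPathHas m y (ts i))
       → RootPathHas m y (node c ls ts)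

-- the path from lca(x,y) to y in T contains an m-edge
data LcaPathHas {n k : ℕ} (m : Fin k) (x y : Fin n) : Tree n k → Set where
  down  : ∀ {c ls ts} (i : Fin c) → x ∈L ts i → y ∈L ts i
        → LcaPathHas m x y (ts i) → LcaPathHas m x y (node c ls ts)
  split : ∀ {c ls ts} (i j : Fin c) → i ≢ j → x ∈L ts i → y ∈L ts j
        → (m ∈ ls j ⊎ RootPathHas m y (ts j))
        → LcaPathHas m x y (node c ls ts)

-- ε : X^×_irr → P(M), represented as a total map whose diagonal values are ignored
EdgeMap : ℕ → ℕ → Set
EdgeMap n k = Fin n → Fin n → Subset k

Explains : {n k : ℕ} → Tree n k → EdgeMap n k → Set
Explains {n} {k} T ε = (x y : Fin n) → x ≢ y → (m : Fin k) → (m ∈ ε x y ⇔ LcaPathHas m x y T)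

IsFitch : {n k : ℕ} → EdgeMap n k → Set
IsFitch {n} {k} ε = Σ (Tree n k) λ T → PhyloTree T × Explains T ε

Distinct3 : {n : ℕ} → Fin n → Fin n → Fin n → Set
Distinct3 a b c = a ≢ b × a ≢ c × b ≢ c

Distinct4 : {n : ℕ} → Fin n → Fin n → Fin n → Fin n → Set
Distinct4 a b c d = a ≢ b × a ≢ c × a ≢ d × b ≢ c × b ≢ d × c ≢ d

CondI : {n k : ℕ} → EdgeMap n k → Fin k → Fin k → Set
CondI {n} ε m m' = (a b c : Fin n) → Distinct3 a b c → m ∈ ε c b → m ∉ ε a b →
  (m ∈ ε c a)
  × (m' ∈ ε a c ⇔ m' ∈ ε b c)
  × (m ≢ m' → m' ∉ ε c b → m' ∉ ε a b)

CondII : {n k : ℕ} → EdgeMap n k → Fin k → Fin k → Set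
CondII {n} ε m m' = (a b c d : Fin n) → Distinct4 a b c d → m ∈ ε c b → m ∉ ε a b →
  m ≢ m' → m' ∉ ε b d → m' ∉ ε c d → m' ∉ ε a d

-- Necessity is checked at the root of the tree: each of conditions (1)–(4) either holds
-- there because the relevant lca-paths leave the root through different children, or is
-- inherited from the one child that contains all the leaves involved.
--
-- For sufficiency, condition (1) makes the sets C(m,z) = {z} ∪ {x | m ∉ ε(x,z)} satisfy
-- y ∈ C(m,z) ⇒ C(m,y) ⊆ C(m,z), and (2)–(4) make any two overlapping ones nested.  Such a
-- hierarchy of coloured clusters is displayed by a tree in which the edge above a vertex
-- with leaf set S carries colour m iff S is a cluster of colour m; it is built by splitting
-- S into the largest cluster strictly inside S containing a chosen leaf, and the rest.  In
-- that tree m lies on the path from lca(x,y) to y iff some m-cluster contains y but not x,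
-- which for the clusters C(m,·) means exactly m ∈ ε(x,y).

module Submission where

open import Defs
open import Data.Nat using (ℕ; zero; suc; _≤_; s≤s; z≤n)
open import Data.Nat.Properties using (<⇒≱)
open import Data.Bool.Properties using (T-≡) renaming (_≟_ to _≟ᵇ_)
open import Data.Empty using (⊥)
open import Data.Fin using (Fin; zero; suc)
open import Data.Fin.Properties using (_≟_; any?)
open import Data.Fin.Subset
  using (Subset; _∈_; _∉_; _⊆_; _⊂_; _⊄_; ⁅_⁆; _∩_; ∁; ⊤; ∣_∣; Nonempty)
open import Data.Fin.Subset.Properties
  using (_∈?_; _⊂?_; nonempty?; ⊆-trans; ⊆-reflexive; ⊆-antisym; p⊂q⇒∣p∣<∣q∣; ∈⊤; ⊆⊤;
         x∈⁅x⁆; x∈⁅y⁆⇒x≡y; x∈p∩q⁺; x∈p∩q⁻; x∈∁p⇒x∉p; x∉p⇒x∈∁p)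
open import Data.Fin.Subset.Induction using (⊂-wellFounded)
open import Data.List using (List; filter; allFin; cartesianProductWith)
open import Data.List.Extrema.Nat using (argmax; argmax-sel; argmax-all; f[xs]≤f[argmax])
open import Data.List.Membership.Propositional using () renaming (_∈_ to _∈ₗ_)
open import Data.List.Membership.Propositional.Properties
  using (∈-filter⁺; ∈-filter⁻; ∈-cartesianProductWith⁺; ∈-cartesianProductWith⁻; ∈-allFin)
import Data.List.Relation.Unary.All as All
open import Data.List.Relation.Unary.All.Properties using (all-filter)
open import Data.Vec using (tabulate)
open import Data.Vec.Properties using (≡-dec; lookup∘tabulate; []=⇒lookup; lookup⇒[]=)
open import Data.Product using (∃; _×_; _,_; proj₁; proj₂)
open import Data.Sum using (_⊎_; inj₁; inj₂; swap)
open import Function using (_∘_; case_of_)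
open import Function.Bundles using (_⇔_; mk⇔; Equivalence)
open import Function.Construct.Composition using (_⇔-∘_)
open import Induction.WellFounded using (Acc; acc)
open import Level using (0ℓ)
open import Relation.Nullary using (¬_; yes; no; contradiction)
open import Relation.Nullary.Decidable
  using (isYes; toWitness; fromWitness; decidable-stable; _×-dec_; _⊎-dec_; ¬?)
open import Relation.Unary using (Pred; Decidable)
open import Relation.Binary.PropositionalEquality using (_≡_; _≢_; refl; sym; trans; subst; ≢-sym)

private
  variable
    n : ℕ
    p q r : Subset n

⊆-or-counterexample : (p q : Subset n) → p ⊆ q ⊎ ∃ λ x → x ∈ p × x ∉ q
⊆-or-counterexample p q with nonempty? (p ∩ ∁ q)
... | yes (x , x∈p∖q) with x∈p , x∈∁q ← x∈p∩q⁻ p (∁ q) x∈p∖q =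
  inj₂ (x , x∈p , x∈∁p⇒x∉p x∈∁q)
... | no ∄ = inj₁ λ {x} x∈p → decidable-stable (x ∈? q) λ x∉q →
  ∄ (x , x∈p∩q⁺ (x∈p , x∉p⇒x∈∁p x∉q))

p⊆q∧p⊄q⇒q⊆p : p ⊆ q → p ⊄ q → q ⊆ p
p⊆q∧p⊄q⇒q⊆p {p = p} {q} p⊆q p⊄q with ⊆-or-counterexample q p
... | inj₁ q⊆p = q⊆p
... | inj₂ (x , x∈q , x∉p) = contradiction ((λ {_} → p⊆q) , x , x∈q , x∉p) p⊄q

p⊆q∧∣q∣≤∣p∣⇒q⊆p : p ⊆ q → ∣ q ∣ ≤ ∣ p ∣ → q ⊆ p
p⊆q∧∣q∣≤∣p∣⇒q⊆p p⊆q ∣q∣≤∣p∣ =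
  p⊆q∧p⊄q⇒q⊆p p⊆q λ p⊂q → <⇒≱ (p⊂q⇒∣p∣<∣q∣ p⊂q) ∣q∣≤∣p∣

⊆-⊂-trans : p ⊆ q → q ⊂ r → p ⊂ r
⊆-⊂-trans p⊆q (q⊆r , x , x∈r , x∉q) = (λ {_} → q⊆r ∘ p⊆q) , x , x∈r , x∉q ∘ p⊆q

fromDec : {P : Pred (Fin n) 0ℓ} → Decidable P → Subset n
fromDec P? = tabulate (isYes ∘ P?)

∈-fromDec : {P : Pred (Fin n) 0ℓ} (P? : Decidable P) {x : Fin n} → x ∈ fromDec P? ⇔ P x
∈-fromDec P? {x} = mk⇔
  (λ x∈ → toWitness (Equivalence.from T-≡ (trans (sym (lookup∘tabulate _ x)) ([]=⇒lookup x∈))))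
  (λ Px → lookup⇒[]= x _ (trans (lookup∘tabulate _ x) (Equivalence.to T-≡ (fromWitness Px))))

module _ {n k : ℕ} where

  EdgePathHas : Fin k → Fin n → Subset k → Tree n k → Set
  EdgePathHas m y l t = m ∈ l ⊎ RootPathHas m y t

  child-unique : ∀ {c ls ts x} {i j : Fin c} → Phylo {n} {k} (node c ls ts) →
                 x ∈L ts i → x ∈L ts j → i ≡ j
  child-unique (nodeP _ _ disjoint) x∈i x∈j = disjoint _ _ _ x∈i x∈j

  lcaPath-child : ∀ {c ls ts m x y} {i : Fin c} → Phylo {n} {k} (node c ls ts) →
                  x ∈L ts i → y ∈L ts i →
                  LcaPathHas m x y (node c ls ts) → LcaPathHas m x y (ts i)
  lcaPath-child ph x∈i y∈i (down _ x∈i′ _ p) with refl ← child-unique ph x∈i x∈i′ = p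
  lcaPath-child ph x∈i y∈i (split _ _ i≢j x∈i′ y∈j _)
    with refl ← child-unique ph x∈i x∈i′ | refl ← child-unique ph y∈i y∈j = contradiction refl i≢j

  lcaPath-split : ∀ {c ls ts m x y} {i j : Fin c} → Phylo {n} {k} (node c ls ts) →
                  x ∈L ts i → y ∈L ts j → i ≢ j →
                  LcaPathHas m x y (node c ls ts) → EdgePathHas m y (ls j) (ts j)
  lcaPath-split ph x∈i y∈j i≢j (down _ x∈i′ y∈i′ _)
    with refl ← child-unique ph x∈i x∈i′ | refl ← child-unique ph y∈j y∈i′ = contradiction refl i≢j
  lcaPath-split ph x∈i y∈j i≢j (split _ _ _ _ y∈j′ e) with refl ← child-unique ph y∈j y∈j′ = e

  lcaPath⇒rootPath : ∀ {m x y} {T : Tree n k} → LcaPathHas m x y T → RootPathHas m y T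
  lcaPath⇒rootPath (down i _ y∈i p)     = step i y∈i (inj₂ (lcaPath⇒rootPath p))
  lcaPath⇒rootPath (split _ j _ _ y∈j e) = step j y∈j e

  -- An m-edge on the root path to y but not below lca(x,y) lies above lca(x,y).
  rootPath-aboveLca : ∀ {m x y} {T : Tree n k} → Phylo T → x ∈L T →
                      RootPathHas m y T → ¬ LcaPathHas m x y T → RootPathHas m x T
  rootPath-aboveLca (nodeP _ phs _) (there i x∈i) (step j y∈j e) ¬lca with i ≟ j
  ... | no i≢j = contradiction (split i j i≢j x∈i y∈j e) ¬lca
  rootPath-aboveLca (nodeP _ phs _) (there i x∈i) (step i y∈i (inj₁ m∈l)) ¬lca | yes refl =
    step i x∈i (inj₁ m∈l)
  rootPath-aboveLca (nodeP _ phs _) (there i x∈i) (step i y∈i (inj₂ p)) ¬lca | yes refl =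
    step i x∈i (inj₂ (rootPath-aboveLca (phs i) x∈i p (¬lca ∘ down i x∈i y∈i)))

  same-child : ∀ {c ls ts m a b d} {i j l : Fin c} → Phylo {n} {k} (node c ls ts) →
               a ∈L ts i → b ∈L ts j → d ∈L ts l →
               LcaPathHas m d b (node c ls ts) → ¬ LcaPathHas m a b (node c ls ts) → i ≡ j
  same-child {i = i} {j} {l} ph a∈i b∈j d∈l db ¬ab with i ≟ j
  ... | yes i≡j = i≡j
  ... | no i≢j with l ≟ j
  ... | yes refl = contradiction (split i j i≢j a∈i b∈j (inj₂ (lcaPath⇒rootPath (lcaPath-child ph d∈l b∈j db))))
                                 ¬ab
  ... | no l≢j   = contradiction (split i j i≢j a∈i b∈j (lcaPath-split ph d∈l b∈j l≢j db)) ¬ab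

  lcaPath-cond₁ : ∀ {m a b c} {T : Tree n k} → Phylo T → a ∈L T → b ∈L T → c ∈L T →
                  LcaPathHas m c b T → ¬ LcaPathHas m a b T → LcaPathHas m c a T
  lcaPath-cond₁ ph@(nodeP _ phs _) (there i a∈i) (there j b∈j) (there l c∈l) cb ¬ab
    with refl ← same-child ph a∈i b∈j c∈l cb ¬ab | l ≟ i
  ... | yes refl = down i c∈l a∈i
                     (lcaPath-cond₁ (phs i) a∈i b∈j c∈l (lcaPath-child ph c∈l b∈j cb)
                                    (¬ab ∘ down i a∈i b∈j))
  ... | no l≢i with lcaPath-split ph c∈l b∈j l≢i cb
  ...   | inj₁ m∈ls = split l i l≢i c∈l a∈i (inj₁ m∈ls)
  ...   | inj₂ p    =
    split l i l≢i c∈l a∈i (inj₂ (rootPath-aboveLca (phs i) a∈i p (¬ab ∘ down i a∈i b∈j)))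

  lcaPath-cond₂ : ∀ {m m′ a b c} {T : Tree n k} → Phylo T → a ∈L T → b ∈L T → c ∈L T →
                  LcaPathHas m c b T → ¬ LcaPathHas m a b T →
                  LcaPathHas m′ a c T ⇔ LcaPathHas m′ b c T
  lcaPath-cond₂ ph@(nodeP _ phs _) (there i a∈i) (there j b∈j) (there l c∈l) cb ¬ab
    with refl ← same-child ph a∈i b∈j c∈l cb ¬ab | l ≟ i
  ... | yes refl =
    let ih = lcaPath-cond₂ (phs i) a∈i b∈j c∈l (lcaPath-child ph c∈l b∈j cb) (¬ab ∘ down i a∈i b∈j)
    in mk⇔ (λ p → down i b∈j c∈l (Equivalence.to ih (lcaPath-child ph a∈i c∈l p)))
           (λ p → down i a∈i c∈l (Equivalence.from ih (lcaPath-child ph b∈j c∈l p)))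
  ... | no l≢i = let i≢l = ≢-sym l≢i in
    mk⇔ (λ p → split i l i≢l b∈j c∈l (lcaPath-split ph a∈i c∈l i≢l p))
        (λ p → split i l i≢l a∈i c∈l (lcaPath-split ph b∈j c∈l i≢l p))

  lcaPath-cond₃ : ∀ {m m′ a b c} {T : Tree n k} → Phylo T → a ∈L T → b ∈L T → c ∈L T →
                  LcaPathHas m c b T → ¬ LcaPathHas m a b T →
                  ¬ LcaPathHas m′ c b T → ¬ LcaPathHas m′ a b T
  lcaPath-cond₃ ph@(nodeP _ phs _) (there i a∈i) (there j b∈j) (there l c∈l) cb ¬ab ¬cb′ ab′
    with refl ← same-child ph a∈i b∈j c∈l cb ¬ab | l ≟ i
  ... | yes refl = lcaPath-cond₃ (phs i) a∈i b∈j c∈l (lcaPath-child ph c∈l b∈j cb)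
                     (¬ab ∘ down i a∈i b∈j) (¬cb′ ∘ down i c∈l b∈j) (lcaPath-child ph a∈i b∈j ab′)
  ... | no l≢i   =
    ¬cb′ (split l i l≢i c∈l b∈j (inj₂ (lcaPath⇒rootPath (lcaPath-child ph a∈i b∈j ab′))))

  lcaPath-cond₄ : ∀ {m m′ a b c d} {T : Tree n k} → Phylo T →
                  a ∈L T → b ∈L T → c ∈L T → d ∈L T →
                  LcaPathHas m c b T → ¬ LcaPathHas m a b T →
                  ¬ LcaPathHas m′ b d T → ¬ LcaPathHas m′ c d T → ¬ LcaPathHas m′ a d T
  lcaPath-cond₄ ph@(nodeP _ phs _) (there i a∈i) (there j b∈j) (there l c∈l) (there o d∈o)
                cb ¬ab ¬bd ¬cd ad
    with refl ← same-child ph a∈i b∈j c∈l cb ¬ab | o ≟ i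
  ... | no o≢i = ¬bd (split i o (≢-sym o≢i) b∈j d∈o (lcaPath-split ph a∈i d∈o (≢-sym o≢i) ad))
  ... | yes refl with l ≟ i
  ...   | no l≢i   =
    ¬cd (split l i l≢i c∈l d∈o (inj₂ (lcaPath⇒rootPath (lcaPath-child ph a∈i d∈o ad))))
  ...   | yes refl = lcaPath-cond₄ (phs i) a∈i b∈j c∈l d∈o (lcaPath-child ph c∈l b∈j cb)
                       (¬ab ∘ down i a∈i b∈j) (¬bd ∘ down i b∈j d∈o)
                       (¬cd ∘ down i c∈l d∈o) (lcaPath-child ph a∈i d∈o ad)

fitch⇒conditions : ∀ {n k} (ε : EdgeMap n k) → IsFitch ε →
                   (m m′ : Fin k) → CondI ε m m′ × CondII ε m m′
fitch⇒conditions ε (T , (ph , ∈T) , explains) m m′ = condI , condII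
  where
  ε⇒lca : ∀ {x y m} → x ≢ y → m ∈ ε x y → LcaPathHas m x y T
  ε⇒lca x≢y = Equivalence.to (explains _ _ x≢y _)
  lca⇒ε : ∀ {x y m} → x ≢ y → LcaPathHas m x y T → m ∈ ε x y
  lca⇒ε x≢y = Equivalence.from (explains _ _ x≢y _)

  condI : CondI ε m m′
  condI a b c (a≢b , a≢c , b≢c) m∈cb m∉ab =
    lca⇒ε (≢-sym a≢c) (lcaPath-cond₁ ph (∈T a) (∈T b) (∈T c) cb ¬ab) ,
    mk⇔ (λ p → lca⇒ε b≢c (Equivalence.to cond₂ (ε⇒lca a≢c p)))
        (λ p → lca⇒ε a≢c (Equivalence.from cond₂ (ε⇒lca b≢c p))) ,
    λ _ m′∉cb m′∈ab → lcaPath-cond₃ ph (∈T a) (∈T b) (∈T c) cb ¬ab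
                         (m′∉cb ∘ lca⇒ε (≢-sym b≢c)) (ε⇒lca a≢b m′∈ab)
    where
    cb : LcaPathHas m c b T
    cb = ε⇒lca (≢-sym b≢c) m∈cb
    ¬ab : ¬ LcaPathHas m a b T
    ¬ab = m∉ab ∘ lca⇒ε a≢b
    cond₂ : LcaPathHas m′ a c T ⇔ LcaPathHas m′ b c T
    cond₂ = lcaPath-cond₂ ph (∈T a) (∈T b) (∈T c) cb ¬ab

  condII : CondII ε m m′
  condII a b c d (a≢b , a≢c , a≢d , b≢c , b≢d , c≢d) m∈cb m∉ab _ m′∉bd m′∉cd m′∈ad =
    lcaPath-cond₄ ph (∈T a) (∈T b) (∈T c) (∈T d)
      (ε⇒lca (≢-sym b≢c) m∈cb) (m∉ab ∘ lca⇒ε a≢b)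
      (m′∉bd ∘ lca⇒ε b≢d) (m′∉cd ∘ lca⇒ε c≢d) (ε⇒lca a≢d m′∈ad)

module Hierarchy {n k : ℕ} (H : Fin k → Fin n → Subset n)
  (nested : ∀ {m z m′ z′ x} → x ∈ H m z → x ∈ H m′ z′ → H m z ⊆ H m′ z′ ⊎ H m′ z′ ⊆ H m z)
  where

  Compatible : Subset n → Set
  Compatible S = ∀ {m z x} → x ∈ H m z → x ∈ S → H m z ⊆ S ⊎ S ⊆ H m z

  Separates : Subset n → Fin k → Fin n → Fin n → Set
  Separates S m x y = ∃ λ z → y ∈ H m z × x ∉ H m z × H m z ⊆ S

  Within : Subset n → Fin k → Fin n → Set
  Within S m y = ∃ λ z → y ∈ H m z × H m z ⊆ S

  ProperlyWithin : Subset n → Fin k → Fin n → Set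
  ProperlyWithin S m y = ∃ λ z → y ∈ H m z × H m z ⊂ S

  labels : Subset n → Subset k
  labels S = fromDec (λ m → any? λ z → ≡-dec _≟ᵇ_ (H m z) S)

  ∈-labels : ∀ {S m} → m ∈ labels S ⇔ ∃ λ z → H m z ≡ S
  ∈-labels = ∈-fromDec _

  record Displays (S : Subset n) (T : Tree n k) : Set where
    field
      phylo    : Phylo T
      leaf⇒∈   : ∀ {x} → x ∈L T → x ∈ S
      ∈⇒leaf   : ∀ {x} → x ∈ S → x ∈L T
      lcaPath  : ∀ {m x y} → x ∈ S → y ∈ S → LcaPathHas m x y T ⇔ Separates S m x y
      rootPath : ∀ {m y} → y ∈ S → RootPathHas m y T ⇔ ProperlyWithin S m y

  edgePath⇔within : ∀ {S T m y} → Displays S T → y ∈ S →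
                    EdgePathHas m y (labels S) T ⇔ Within S m y
  edgePath⇔within {S} {T} {m} {y} D y∈S = mk⇔ to from
    where
    open Displays D
    to : EdgePathHas m y (labels S) T → Within S m y
    to (inj₁ m∈labels) with z , Hmz≡S ← Equivalence.to ∈-labels m∈labels =
      z , subst (_ ∈_) (sym Hmz≡S) y∈S , ⊆-reflexive Hmz≡S
    to (inj₂ p) with z , y∈H , H⊂S ← Equivalence.to (rootPath y∈S) p = z , y∈H , proj₁ H⊂S
    from : Within S m y → EdgePathHas m y (labels S) T
    from (z , y∈H , H⊆S) with H m z ⊂? S
    ... | yes H⊂S = inj₂ (Equivalence.from (rootPath y∈S) (z , y∈H , H⊂S))
    ... | no H⊄S  = inj₁ (Equivalence.from ∈-labels (z , ⊆-antisym H⊆S (p⊆q∧p⊄q⇒q⊆p H⊆S H⊄S)))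

  leaf-displays : ∀ {S y} → y ∈ S → S ⊆ ⁅ y ⁆ → Displays S (leaf y)
  leaf-displays {S} {y} y∈S S⊆⁅y⁆ = record
    { phylo    = leafP y
    ; leaf⇒∈   = λ { here → y∈S }
    ; ∈⇒leaf   = λ x∈S → subst (_∈L leaf y) (same y∈S x∈S) here
    ; lcaPath  = λ x∈S y′∈S → mk⇔ (λ ())
                   λ (_ , y′∈H , x∉H , _) → contradiction (subst (_∈ _) (same y′∈S x∈S) y′∈H) x∉H
    ; rootPath = λ y′∈S → mk⇔ (λ ())
                   λ (_ , y′∈H , _ , v , v∈S , v∉H) → contradiction (subst (_∈ _) (same y′∈S v∈S) y′∈H) v∉H
    }
    where
    same : ∀ {x x′} → x ∈ S → x′ ∈ S → x ≡ x′
    same x∈S x′∈S = trans (x∈⁅y⁆⇒x≡y y (S⊆⁅y⁆ x∈S)) (sym (x∈⁅y⁆⇒x≡y y (S⊆⁅y⁆ x′∈S)))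

  record Partition (S : Subset n) : Set where
    field
      size       : ℕ
      2≤size     : 2 ≤ size
      part       : Fin size → Subset n
      part⊂      : ∀ i → part i ⊂ S
      nonempty   : ∀ i → Nonempty (part i)
      compatible : ∀ i → Compatible (part i)
      cover      : ∀ {x} → x ∈ S → ∃ λ i → x ∈ part i
      disjoint   : ∀ {i j x} → x ∈ part i → x ∈ part j → i ≡ j
      absorbs    : ∀ {i m z y} → y ∈ part i → y ∈ H m z → H m z ⊂ S → H m z ⊆ part i

  module _ {S : Subset n} (P : Partition S) where
    open Partition P

    within-part⇔properlyWithin : ∀ {i m y} → y ∈ part i →
                                 Within (part i) m y ⇔ ProperlyWithin S m y
    within-part⇔properlyWithin {i} y∈i = mk⇔
      (λ (z , y∈H , H⊆i) → z , y∈H , ⊆-⊂-trans H⊆i (part⊂ i))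
      (λ (z , y∈H , H⊂S) → z , y∈H , absorbs y∈i y∈H H⊂S)

    separates-part : ∀ {i m x y} → x ∈ part i → y ∈ part i →
                     Separates (part i) m x y ⇔ Separates S m x y
    separates-part {i} x∈i y∈i = mk⇔
      (λ (z , y∈H , x∉H , H⊆i) → z , y∈H , x∉H , ⊆-trans H⊆i (proj₁ (part⊂ i)))
      (λ (z , y∈H , x∉H , H⊆S) → z , y∈H , x∉H ,
         absorbs y∈i y∈H ((λ {_} → H⊆S) , _ , proj₁ (part⊂ i) x∈i , x∉H))

    separates-split : ∀ {i j m x y} → x ∈ part i → y ∈ part j → i ≢ j →
                      Within (part j) m y ⇔ Separates S m x y
    separates-split {j = j} x∈i y∈j i≢j = mk⇔
      (λ (z , y∈H , H⊆j) →
         z , y∈H , (λ x∈H → i≢j (disjoint x∈i (H⊆j x∈H))) , ⊆-trans H⊆j (proj₁ (part⊂ j)))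
      (λ (z , y∈H , x∉H , H⊆S) →
         z , y∈H , absorbs y∈j y∈H ((λ {_} → H⊆S) , _ , proj₁ (part⊂ _) x∈i , x∉H))

    node-displays : {ts : Fin size → Tree n k} → (∀ i → Displays (part i) (ts i)) →
                    Displays S (node size (labels ∘ part) ts)
    node-displays {ts} D = record
      { phylo    = nodeP 2≤size (phylo ∘ D)
                     λ i j x x∈i x∈j → disjoint (leaf⇒∈ (D i) x∈i) (leaf⇒∈ (D j) x∈j)
      ; leaf⇒∈   = λ { (there i x∈i) → proj₁ (part⊂ i) (leaf⇒∈ (D i) x∈i) }
      ; ∈⇒leaf   = λ x∈S → let i , x∈i = cover x∈S in there i (∈⇒leaf (D i) x∈i)
      ; lcaPath  = λ x∈S y∈S → mk⇔ lca⇒separates (separates⇒lca x∈S y∈S)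
      ; rootPath = λ y∈S → mk⇔ root⇒properlyWithin (properlyWithin⇒root y∈S)
      }
      where
      open Displays

      edgePath⇔properlyWithin : ∀ {i m y} → y ∈ part i →
                                EdgePathHas m y (labels (part i)) (ts i) ⇔ ProperlyWithin S m y
      edgePath⇔properlyWithin {i} y∈i =
        within-part⇔properlyWithin y∈i ⇔-∘ edgePath⇔within (D i) y∈i

      T : Tree n k
      T = node size (labels ∘ part) ts

      root⇒properlyWithin : ∀ {m y} → RootPathHas m y T → ProperlyWithin S m y
      root⇒properlyWithin (step i y∈i e) =
        Equivalence.to (edgePath⇔properlyWithin (leaf⇒∈ (D i) y∈i)) e

      properlyWithin⇒root : ∀ {m y} → y ∈ S → ProperlyWithin S m y → RootPathHas m y T
      properlyWithin⇒root y∈S w = let i , y∈i = cover y∈S in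
        step i (∈⇒leaf (D i) y∈i) (Equivalence.from (edgePath⇔properlyWithin y∈i) w)

      lca⇒separates : ∀ {m x y} → LcaPathHas m x y T → Separates S m x y
      lca⇒separates (down i x∈i y∈i l) =
        Equivalence.to (separates-part (leaf⇒∈ (D i) x∈i) (leaf⇒∈ (D i) y∈i))
          (Equivalence.to (lcaPath (D i) (leaf⇒∈ (D i) x∈i) (leaf⇒∈ (D i) y∈i)) l)
      lca⇒separates (split i j i≢j x∈i y∈j e) =
        Equivalence.to (separates-split (leaf⇒∈ (D i) x∈i) (leaf⇒∈ (D j) y∈j) i≢j)
          (Equivalence.to (edgePath⇔within (D j) (leaf⇒∈ (D j) y∈j)) e)

      separates⇒lca : ∀ {m x y} → x ∈ S → y ∈ S → Separates S m x y → LcaPathHas m x y T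
      separates⇒lca x∈S y∈S sep with i , x∈i ← cover x∈S | j , y∈j ← cover y∈S | i ≟ j
      ... | yes refl = down i (∈⇒leaf (D i) x∈i) (∈⇒leaf (D i) y∈j)
                         (Equivalence.from (lcaPath (D i) x∈i y∈j)
                           (Equivalence.from (separates-part x∈i y∈j) sep))
      ... | no i≢j = split i j i≢j (∈⇒leaf (D i) x∈i) (∈⇒leaf (D j) y∈j)
                       (Equivalence.from (edgePath⇔within (D j) y∈j)
                         (Equivalence.from (separates-split x∈i y∈j i≢j) sep))

  clusters : List (Subset n)
  clusters = cartesianProductWith H (allFin k) (allFin n)

  cluster-compatible : ∀ {C} → C ∈ₗ clusters → Compatible C
  cluster-compatible C∈
    with _ , _ , _ , _ , refl ← ∈-cartesianProductWith⁻ H (allFin k) (allFin n) C∈ = nested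

  singleton-compatible : ∀ {y} → Compatible ⁅ y ⁆
  singleton-compatible {y} x∈H x∈⁅y⁆ =
    inj₂ λ u∈⁅y⁆ → subst (_∈ _) (trans (x∈⁅y⁆⇒x≡y y x∈⁅y⁆) (sym (x∈⁅y⁆⇒x≡y y u∈⁅y⁆))) x∈H

  module Bipartition {S : Subset n} {y : Fin n}
                     (S-compatible : Compatible S) (⁅y⁆⊂S : ⁅ y ⁆ ⊂ S) where

    candidates : List (Subset n)
    candidates = filter (λ C → y ∈? C ×-dec C ⊂? S) clusters

    -- the largest cluster strictly inside S containing y, or ⁅ y ⁆ if there is none
    A : Subset n
    A = argmax ∣_∣ ⁅ y ⁆ candidates

    y∈A×A⊂S : y ∈ A × A ⊂ S
    y∈A×A⊂S = argmax-all ∣_∣ (x∈⁅x⁆ y , ⁅y⁆⊂S) (all-filter (λ C → y ∈? C ×-dec C ⊂? S) clusters)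

    y∈A : y ∈ A
    y∈A = proj₁ y∈A×A⊂S

    A⊂S : A ⊂ S
    A⊂S = proj₂ y∈A×A⊂S

    A-compatible : Compatible A
    A-compatible with argmax-sel ∣_∣ ⁅ y ⁆ candidates
    ... | inj₁ A≡⁅y⁆ = subst Compatible (sym A≡⁅y⁆) singleton-compatible
    ... | inj₂ A∈   = cluster-compatible (proj₁ (∈-filter⁻ _ A∈))

    A-maximal : ∀ {m z} → y ∈ H m z → H m z ⊂ S → H m z ⊆ A
    A-maximal {m} {z} y∈H H⊂S with A-compatible y∈H y∈A
    ... | inj₁ H⊆A = H⊆A
    ... | inj₂ A⊆H = p⊆q∧∣q∣≤∣p∣⇒q⊆p A⊆H ∣H∣≤∣A∣
      where
      H∈candidates : H m z ∈ₗ candidates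
      H∈candidates = ∈-filter⁺ _ (∈-cartesianProductWith⁺ H (∈-allFin m) (∈-allFin z)) (y∈H , H⊂S)
      ∣H∣≤∣A∣ : ∣ H m z ∣ ≤ ∣ A ∣
      ∣H∣≤∣A∣ = All.lookup (f[xs]≤f[argmax] {f = ∣_∣} ⁅ y ⁆ candidates) H∈candidates

    ⊂S⇒⊆A⊎disjoint : ∀ {m z} → H m z ⊂ S → H m z ⊆ A ⊎ (∀ {u} → u ∈ H m z → u ∉ A)
    ⊂S⇒⊆A⊎disjoint {m} {z} H⊂S with ⊆-or-counterexample (H m z) A
    ... | inj₁ H⊆A = inj₁ H⊆A
    ... | inj₂ (v , v∈H , v∉A) = inj₂ λ u∈H u∈A → case A-compatible u∈H u∈A of λ where
      (inj₁ H⊆A) → v∉A (H⊆A v∈H)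
      (inj₂ A⊆H) → v∉A (A-maximal (A⊆H y∈A) H⊂S v∈H)

    B : Subset n
    B = S ∩ ∁ A

    ∈B⁻ : ∀ {x} → x ∈ B → x ∈ S × x ∉ A
    ∈B⁻ x∈B = let x∈S , x∈∁A = x∈p∩q⁻ S (∁ A) x∈B in x∈S , x∈∁p⇒x∉p x∈∁A

    ∈B⁺ : ∀ {x} → x ∈ S → x ∉ A → x ∈ B
    ∈B⁺ x∈S x∉A = x∈p∩q⁺ (x∈S , x∉p⇒x∈∁p x∉A)

    B⊂S : B ⊂ S
    B⊂S = (λ {_} → proj₁ ∘ ∈B⁻) , y , proj₁ A⊂S y∈A , λ y∈B → proj₂ (∈B⁻ y∈B) y∈A

    B-nonempty : Nonempty B
    B-nonempty = let w , w∈S , w∉A = proj₂ A⊂S in w , ∈B⁺ w∈S w∉A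

    B-compatible : Compatible B
    B-compatible {m} {z} x∈H x∈B with ∈B⁻ x∈B
    ... | x∈S , x∉A with S-compatible x∈H x∈S
    ...   | inj₂ S⊆H = inj₂ (S⊆H ∘ proj₁ ∘ ∈B⁻)
    ...   | inj₁ H⊆S with H m z ⊂? S
    ...     | no H⊄S = inj₂ (p⊆q∧p⊄q⇒q⊆p H⊆S H⊄S ∘ proj₁ ∘ ∈B⁻)
    ...     | yes H⊂S with ⊂S⇒⊆A⊎disjoint H⊂S
    ...       | inj₁ H⊆A   = contradiction (H⊆A x∈H) x∉A
    ...       | inj₂ H∩A=∅ = inj₁ λ u∈H → ∈B⁺ (H⊆S u∈H) (H∩A=∅ u∈H)

    part : Fin 2 → Subset n
    part zero       = A
    part (suc zero) = B

    part⊂S : ∀ i → part i ⊂ S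
    part⊂S zero       = A⊂S
    part⊂S (suc zero) = B⊂S

    part-nonempty : ∀ i → Nonempty (part i)
    part-nonempty zero       = y , y∈A
    part-nonempty (suc zero) = B-nonempty

    part-compatible : ∀ i → Compatible (part i)
    part-compatible zero       = A-compatible
    part-compatible (suc zero) = B-compatible

    part-cover : ∀ {x} → x ∈ S → ∃ λ i → x ∈ part i
    part-cover {x} x∈S with x ∈? A
    ... | yes x∈A = zero , x∈A
    ... | no x∉A  = suc zero , ∈B⁺ x∈S x∉A

    part-disjoint : ∀ {i j x} → x ∈ part i → x ∈ part j → i ≡ j
    part-disjoint {zero}     {zero}     _   _   = refl
    part-disjoint {suc zero} {suc zero} _   _   = refl
    part-disjoint {zero}     {suc zero} x∈A x∈B = contradiction x∈A (proj₂ (∈B⁻ x∈B))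
    part-disjoint {suc zero} {zero}     x∈B x∈A = contradiction x∈A (proj₂ (∈B⁻ x∈B))

    part-absorbs : ∀ {i m z u} → u ∈ part i → u ∈ H m z → H m z ⊂ S → H m z ⊆ part i
    part-absorbs {i} u∈i u∈H H⊂S with i | ⊂S⇒⊆A⊎disjoint H⊂S
    ... | zero     | inj₁ H⊆A   = H⊆A
    ... | zero     | inj₂ H∩A=∅ = contradiction u∈i (H∩A=∅ u∈H)
    ... | suc zero | inj₁ H⊆A   = contradiction (H⊆A u∈H) (proj₂ (∈B⁻ u∈i))
    ... | suc zero | inj₂ H∩A=∅ = λ v∈H → ∈B⁺ (proj₁ H⊂S v∈H) (H∩A=∅ v∈H)

    partition : Partition S
    partition = record
      { size       = 2
      ; 2≤size     = s≤s (s≤s z≤n)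
      ; part       = part
      ; part⊂      = part⊂S
      ; nonempty   = part-nonempty
      ; compatible = part-compatible
      ; cover      = part-cover
      ; disjoint   = part-disjoint
      ; absorbs    = λ {i} → part-absorbs {i}
      }

  display : ∀ {S} → Acc _⊂_ S → Nonempty S → Compatible S → ∃ (Displays S)
  display {S} (acc rec) (y , y∈S) S-compatible with ⁅ y ⁆ ⊂? S
  ... | no ⁅y⁆⊄S = leaf y , leaf-displays y∈S (p⊆q∧p⊄q⇒q⊆p ⁅y⁆⊆S ⁅y⁆⊄S)
    where
    ⁅y⁆⊆S : ⁅ y ⁆ ⊆ S
    ⁅y⁆⊆S x∈⁅y⁆ = subst (_∈ S) (sym (x∈⁅y⁆⇒x≡y y x∈⁅y⁆)) y∈S
  ... | yes ⁅y⁆⊂S = node size (labels ∘ part) (proj₁ ∘ child) , node-displays P (proj₂ ∘ child)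
    where
    P : Partition S
    P = Bipartition.partition S-compatible ⁅y⁆⊂S
    open Partition P
    child : ∀ i → ∃ (Displays (part i))
    child i = display (rec (part⊂ i)) (nonempty i) (compatible i)

module Clusters {n k : ℕ} (ε : EdgeMap n k)
  (conditions : (m m′ : Fin k) → CondI ε m m′ × CondII ε m m′) where

  cond₁ : ∀ m {a b c} → Distinct3 a b c → m ∈ ε c b → m ∉ ε a b → m ∈ ε c a
  cond₁ m d m∈cb m∉ab = proj₁ (proj₁ (conditions m m) _ _ _ d m∈cb m∉ab)

  cond₂ : ∀ m m′ {a b c} → Distinct3 a b c → m ∈ ε c b → m ∉ ε a b → m′ ∈ ε a c ⇔ m′ ∈ ε b c
  cond₂ m m′ d m∈cb m∉ab = proj₁ (proj₂ (proj₁ (conditions m m′) _ _ _ d m∈cb m∉ab))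

  cond₃ : ∀ m m′ {a b c} → Distinct3 a b c → m ∈ ε c b → m ∉ ε a b →
          m ≢ m′ → m′ ∉ ε c b → m′ ∉ ε a b
  cond₃ m m′ d m∈cb m∉ab = proj₂ (proj₂ (proj₁ (conditions m m′) _ _ _ d m∈cb m∉ab))

  cond₄ : ∀ m m′ {a b c d} → Distinct4 a b c d → m ∈ ε c b → m ∉ ε a b →
          m ≢ m′ → m′ ∉ ε b d → m′ ∉ ε c d → m′ ∉ ε a d
  cond₄ m m′ = proj₂ (conditions m m′) _ _ _ _

  -- In a tree explaining ε, these are the leaves below the lowest m-edge above z
  -- (all leaves if there is none).
  InCluster : Fin k → Fin n → Pred (Fin n) 0ℓ
  InCluster m z x = x ≡ z ⊎ m ∉ ε x z

  inCluster? : ∀ m z → Decidable (InCluster m z)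
  inCluster? m z x = x ≟ z ⊎-dec ¬? (m ∈? ε x z)

  ¬inCluster : ∀ {m z x} → ¬ InCluster m z x → x ≢ z × m ∈ ε x z
  ¬inCluster {m} {z} {x} x∉ = x∉ ∘ inj₁ , decidable-stable (m ∈? ε x z) (x∉ ∘ inj₂)

  inCluster⇒∉ : ∀ {m z x} → InCluster m z x → x ≢ z → m ∉ ε x z
  inCluster⇒∉ (inj₁ x≡z) x≢z = contradiction x≡z x≢z
  inCluster⇒∉ (inj₂ m∉xz) _  = m∉xz

  inCluster-trans : ∀ {m z y x} → InCluster m z y → InCluster m y x → InCluster m z x
  inCluster-trans {m} {z} {y} {x} y∈z x∈y with y ≟ z | y ≟ x | x ≟ z
  ... | yes refl | _ | _ = x∈y
  ... | _ | yes refl | _ = y∈z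
  ... | _ | _ | yes x≡z = inj₁ x≡z
  ... | no y≢z | no y≢x | no x≢z =
    inj₂ λ m∈xz → inCluster⇒∉ x∈y (≢-sym y≢x)
                    (cond₁ m (y≢z , y≢x , ≢-sym x≢z) m∈xz (inCluster⇒∉ y∈z y≢z))

  centres-overlap : ∀ {m m′ y z w} → InCluster m y w → InCluster m′ z w →
                    InCluster m′ z y ⊎ InCluster m y z
  centres-overlap {m} {m′} {y} {z} {w} w∈y w∈z with inCluster? m′ z y
  ... | yes y∈z = inj₁ y∈z
  ... | no y∉z = inj₂ (decidable-stable (inCluster? m y z) z∉y⇒⊥)
    where
    z∉y⇒⊥ : ¬ InCluster m y z → ⊥
    z∉y⇒⊥ z∉y =
      let y≢z , m′∈yz = ¬inCluster y∉z
          _   , m∈zy  = ¬inCluster z∉y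
          w≢y : w ≢ y
          w≢y = λ { refl → y∉z w∈z }
          w≢z : w ≢ z
          w≢z = λ { refl → z∉y w∈y }
      in inCluster⇒∉ w∈z w≢z
           (Equivalence.from (cond₂ m m′ (w≢y , w≢z , y≢z) m∈zy (inCluster⇒∉ w∈y w≢y)) m′∈yz)

  -- Conditions (2)–(4) rule out the three positions of z relative to y and b.
  crossing-clusters : ∀ {m m′ y z a b} → m ≢ m′ → Distinct3 a y b → m ∈ ε b y → m ∉ ε a y →
                      a ≢ z → m′ ∈ ε a z → InCluster m′ z y → InCluster m′ z b → ⊥
  crossing-clusters {m} {m′} {y} {z} {b = b} m≢m′ a-y-b@(a≢y , a≢b , y≢b) m∈by m∉ay a≢z m′∈az
                    y∈z b∈z with y ≟ z | b ≟ z
  ... | yes refl | _ = cond₃ m m′ a-y-b m∈by m∉ay m≢m′ (inCluster⇒∉ b∈z (≢-sym y≢b)) m′∈az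
  ... | no y≢z | yes refl =
    inCluster⇒∉ y∈z y≢z (Equivalence.to (cond₂ m m′ a-y-b m∈by m∉ay) m′∈az)
  ... | no y≢z | no b≢z =
    cond₄ m m′ (a≢y , a≢b , a≢z , y≢b , y≢z , b≢z) m∈by m∉ay m≢m′
      (inCluster⇒∉ y∈z y≢z) (inCluster⇒∉ b∈z b≢z) m′∈az

  no-crossing : ∀ {m m′ y z a b} → InCluster m′ z y →
                InCluster m y a → ¬ InCluster m′ z a → InCluster m′ z b → ¬ InCluster m y b → ⊥
  no-crossing {m} {m′} {y} {z} {a} {b} y∈z a∈y a∉z b∈z b∉y with m ≟ m′
  ... | yes refl = a∉z (inCluster-trans y∈z a∈y)
  ... | no m≢m′ =
    crossing-clusters m≢m′ (a≢y , a≢b , ≢-sym b≢y) m∈by (inCluster⇒∉ a∈y a≢y) a≢z m′∈az y∈z b∈z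
    where
    a≢y : a ≢ y
    a≢y refl = a∉z y∈z
    a≢b : a ≢ b
    a≢b refl = b∉y a∈y
    a≢z : a ≢ z
    a≢z = proj₁ (¬inCluster a∉z)
    m′∈az : m′ ∈ ε a z
    m′∈az = proj₂ (¬inCluster a∉z)
    b≢y : b ≢ y
    b≢y = proj₁ (¬inCluster b∉y)
    m∈by : m ∈ ε b y
    m∈by = proj₂ (¬inCluster b∉y)

  cluster : Fin k → Fin n → Subset n
  cluster m z = fromDec (inCluster? m z)

  ∈-cluster⁺ : ∀ {m z x} → InCluster m z x → x ∈ cluster m z
  ∈-cluster⁺ = Equivalence.from (∈-fromDec _)

  ∈-cluster⁻ : ∀ {m z x} → x ∈ cluster m z → InCluster m z x
  ∈-cluster⁻ = Equivalence.to (∈-fromDec _)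

  centre∈⇒nested : ∀ {m m′ y z} → y ∈ cluster m′ z →
                   cluster m y ⊆ cluster m′ z ⊎ cluster m′ z ⊆ cluster m y
  centre∈⇒nested {m} {m′} {y} {z} y∈z with ⊆-or-counterexample (cluster m y) (cluster m′ z)
  ... | inj₁ ⊆ = inj₁ ⊆
  ... | inj₂ (a , a∈y , a∉z) = inj₂ λ {b} b∈z → decidable-stable (b ∈? cluster m y) λ b∉y →
    no-crossing (∈-cluster⁻ y∈z) (∈-cluster⁻ a∈y) (a∉z ∘ ∈-cluster⁺)
                (∈-cluster⁻ b∈z) (b∉y ∘ ∈-cluster⁺)

  clusters-nested : ∀ {m y m′ z x} → x ∈ cluster m y → x ∈ cluster m′ z →
                    cluster m y ⊆ cluster m′ z ⊎ cluster m′ z ⊆ cluster m y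
  clusters-nested x∈y x∈z with centres-overlap (∈-cluster⁻ x∈y) (∈-cluster⁻ x∈z)
  ... | inj₁ y∈z = centre∈⇒nested (∈-cluster⁺ y∈z)
  ... | inj₂ z∈y = swap (centre∈⇒nested (∈-cluster⁺ z∈y))

conditions⇒fitch : ∀ {n k} (ε : EdgeMap (suc n) k) →
                   ((m m′ : Fin k) → CondI ε m m′ × CondII ε m m′) → IsFitch ε
conditions⇒fitch ε conditions = T , (phylo , λ _ → ∈⇒leaf ∈⊤) , explains
  where
  open Clusters ε conditions
  open Hierarchy cluster clusters-nested
  T,D : ∃ (Displays ⊤)
  T,D = display (⊂-wellFounded ⊤) (zero , ∈⊤) (λ _ _ → inj₁ ⊆⊤)
  T : Tree _ _
  T = proj₁ T,D
  open Displays (proj₂ T,D)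

  explains : Explains T ε
  explains x y x≢y m = mk⇔ (Equivalence.from (lcaPath ∈⊤ ∈⊤) ∘ ε⇒separates)
                              (separates⇒ε ∘ Equivalence.to (lcaPath ∈⊤ ∈⊤))
    where
    ε⇒separates : m ∈ ε x y → Separates ⊤ m x y
    ε⇒separates m∈xy =
      y , ∈-cluster⁺ (inj₁ refl) , (λ x∈y → inCluster⇒∉ (∈-cluster⁻ x∈y) x≢y m∈xy) , ⊆⊤
    separates⇒ε : Separates ⊤ m x y → m ∈ ε x y
    separates⇒ε (z , y∈z , x∉z , _) = decidable-stable (m ∈? ε x y) λ m∉xy →
      x∉z (∈-cluster⁺ (inCluster-trans (∈-cluster⁻ y∈z) (inj₂ m∉xy)))

theorem2 : (n k : ℕ) → 1 ≤ n → 1 ≤ k → (ε : EdgeMap n k)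
    → IsFitch ε ⇔ ((m m' : Fin k) → CondI ε m m' × CondII ε m m')
theorem2 zero    _ () _ _
theorem2 (suc _) _ _  _ ε = mk⇔ (fitch⇒conditions ε) (conditions⇒fitch ε)
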